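{- Let $\lambda>0$ and let $G$ be a $\lambda$-quasi-regularizable graph of order $n$ with independence number $\alpha(G)$, and let $s_k$ denote the number of independent sets of size $k$ in $G$. Then: (i) $(k+1)\cdot s_{k+1}\leq (n-(\lambda+1)k)\cdot s_k$ for every $0\leq k<\alpha(G)$; (ii) $s_r\geq s_{r+1}\geq\cdots\geq s_{\alpha(G)}$, where $r=\left\lceil \frac{n-1}{\lambda+2}\right\rceil$.
   Context: All graphs are finite, simple, undirected, with nonempty vertex set. An independent set is a set of pairwise non-adjacent vertices; $\alpha(G)$ is the maximum size of an independent set. For $A\subseteq V(G)$, $N(A)=\{v\in V(G): v \text{ is adjacent to some vertex of } A\}$. For $\lambda>0$, a graph $G$ is called $\lambda$-quasi-regularizable if $\lambda\cdot|S|\leq|N(S)|$ for every independent set $S$ of $G$. $s_0=1$ (the empty set).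
   Formalization: The parameter λ ranges over the positive rationals. -}

module Defs where

open import Data.Bool using (Bool; true; false)
open import Data.Nat as ℕ using (ℕ; zero; suc)
open import Data.Fin using (Fin)
open import Data.Fin.Subset using (Subset; _∈_; ∣_∣; inside; outside)
open import Data.Fin.Subset.Properties using (_∈?_)
open import Data.Fin.Properties using (any?; all?)
open import Data.Vec using (Vec; []; _∷_; tabulate)
open import Data.List using (List; []; _∷_; map; _++_; filter; length)
open import Data.Product using (Σ; _×_; _,_; ∃)
open import Data.Integer as ℤ using (ℤ; +_)
open import Data.Rational as ℚ using (ℚ; _/_; _+_; _*_; _÷_; _-_; 0ℚ; 1ℚ; _≤_; _<_; Positive; positive)
open import Data.Rational.Properties using (pos⇒nonZero; pos+pos⇒pos)
open import Relation.Binary.PropositionalEquality using (_≡_; refl)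
open import Relation.Nullary using (Dec; yes; no; does)
open import Relation.Nullary.Decidable using (_→-dec_; _×-dec_; ⌊_⌋)
open import Data.Bool using (T)
import Data.Bool.Properties as BoolP

record Graph (n : ℕ) : Set where
  field
    adj   : Fin n → Fin n → Bool
    sym   : ∀ u v → adj u v ≡ adj v u
    irref : ∀ v → adj v v ≡ false
open Graph public

Adj : ∀ {n} → Graph n → Fin n → Fin n → Set
Adj G u v = adj G u v ≡ true

Independent : ∀ {n} → Graph n → Subset n → Set
Independent G S = ∀ u v → u ∈ S → v ∈ S → ¬Adj u v
  where ¬Adj : _ → _ → Set
        ¬Adj u v = adj G u v ≡ false

independent? : ∀ {n} (G : Graph n) (S : Subset n) → Dec (Independent G S)
independent? G S = all? λ u → all? λ v →
  (u ∈? S) →-dec ((v ∈? S) →-dec (adj G u v BoolP.≟ false))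

N : ∀ {n} → Graph n → Subset n → Subset n
N G A = tabulate λ v → ⌊ any? (λ u → (u ∈? A) ×-dec (adj G u v BoolP.≟ true)) ⌋

allSubsets : (n : ℕ) → List (Subset n)
allSubsets zero    = [] ∷ []
allSubsets (suc n) = map (inside ∷_) (allSubsets n) ++ map (outside ∷_) (allSubsets n)

s : ∀ {n} → Graph n → ℕ → ℕ
s {n} G k = length (filter (λ S → independent? G S ×-dec (∣ S ∣ ℕ.≟ k)) (allSubsets n))

IsIndependenceNumber : ∀ {n} → Graph n → ℕ → Set
IsIndependenceNumber {n} G a =
  (∃ λ (S : Subset n) → Independent G S × ∣ S ∣ ≡ a) ×
  (∀ (S : Subset n) → Independent G S → ∣ S ∣ ℕ.≤ a)

ℕ→ℚ : ℕ → ℚ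
ℕ→ℚ m = (+ m) / 1

QuasiRegularizable : ∀ {n} → ℚ → Graph n → Set
QuasiRegularizable {n} λ' G =
  ∀ (S : Subset n) → Independent G S → λ' * ℕ→ℚ ∣ S ∣ ≤ ℕ→ℚ ∣ N G S ∣

rIndex : ℕ → (λ' : ℚ) → 0ℚ < λ' → ℤ
rIndex n λ' λpos =
  let instance
        p : Positive λ'
        p = positive λpos
        q : Positive (λ' + ℕ→ℚ 2)
        q = pos+pos⇒pos λ' (ℕ→ℚ 2)
        nz = pos⇒nonZero (λ' + ℕ→ℚ 2)
  in ℚ.⌈ (ℕ→ℚ n - 1ℚ) ÷ (λ' + ℕ→ℚ 2) ⌉

module Submission where

-- Write I_k for the independent k-sets.  Double counting the pairs (T′, v) with T′ ∈ I_{k+1} and v ∈ T′ gives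
--   (k+1)·s_{k+1} = Σ_{T ∈ I_k} |V ∖ (T ∪ N(T))| = Σ_{T ∈ I_k} (n − k − |N(T)|),
-- because removing v from T′ leaves some T ∈ I_k with v ∉ T ∪ N(T), and conversely.  Quasi-regularizability
-- gives |N(T)| ≥ λk, which is (i).  For j ≥ ⌈(n−1)/(λ+2)⌉ the coefficient n − (λ+1)j is at most j+1, so (i)
-- yields s_{j+1} ≤ s_j.

module Counting where

  open import Data.Bool using (Bool; true; false; not; _∧_)
  import Data.Bool.Properties as Bool
  open import Data.Nat using (ℕ; zero; suc; _+_; _*_; _≟_)
  open import Data.Nat.Properties
    using (+-assoc; +-comm; *-comm; *-zeroʳ; *-identityʳ; +-identityʳ; *-distribˡ-+; suc-injective;
           +-commutativeSemigroup; +-*-semiring)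
  open import Algebra.Properties.CommutativeSemigroup +-commutativeSemigroup using (interchange)
  open import Algebra.Properties.Semiring.Sum +-*-semiring
    using (sum; sum-syntax; sum-cong-≗; sum-replicate-zero; ∑-distrib-+; *-distribˡ-sum)
  open import Data.Fin using (Fin; zero; suc)
  open import Data.Fin.Properties using (any?) renaming (_≟_ to _≟ᶠ_)
  open import Data.Fin.Subset using (Subset; _∈_; ∣_∣; inside; outside)
  open import Data.Fin.Subset.Properties using (_∈?_)
  open import Data.Vec using ([]; _∷_; lookup; _[_]%=_)
  open import Data.Vec.Properties
    using ([]=⇒lookup; lookup⇒[]=; lookup∘tabulate; lookup∘updateAt; lookup∘updateAt′)
  open import Data.List using (List; []; _∷_; map; _++_; filter; length)
  open import Data.Product using (∃; _×_; _,_; proj₂)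
  open import Data.Empty using (⊥)
  open import Function using (_∘_; _⇔_; mk⇔)
  open import Relation.Binary.PropositionalEquality
  open import Relation.Nullary using (Dec; does; yes; no; contradiction)
  open import Relation.Nullary.Decidable using (_×-dec_; isYes≗does; does-⇔)
  open import Defs using (Graph; adj; irref; Adj; Independent; independent?; N; s; allSubsets)
    renaming (sym to adj-sym)

  sumOver : {A : Set} → List A → (A → ℕ) → ℕ
  sumOver []       f = 0
  sumOver (x ∷ xs) f = f x + sumOver xs f

  infixl 10 sumOver
  syntax sumOver xs (λ x → e) = ∑[ x ∈ xs ] e

  module _ {A : Set} where

    ∑∈-cong : ∀ (xs : List A) {f g : A → ℕ} → (∀ x → f x ≡ g x) →
              ∑[ x ∈ xs ] f x ≡ ∑[ x ∈ xs ] g x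
    ∑∈-cong []       f≗g = refl
    ∑∈-cong (x ∷ xs) f≗g = cong₂ _+_ (f≗g x) (∑∈-cong xs f≗g)

    ∑∈-++ : ∀ (xs ys : List A) (f : A → ℕ) →
            ∑[ x ∈ xs ++ ys ] f x ≡ ∑[ x ∈ xs ] f x + ∑[ y ∈ ys ] f y
    ∑∈-++ []       ys f = refl
    ∑∈-++ (x ∷ xs) ys f = trans (cong (f x +_) (∑∈-++ xs ys f)) (sym (+-assoc (f x) _ _))

    ∑∈-map : ∀ {B : Set} (h : A → B) (xs : List A) (f : B → ℕ) →
             ∑[ y ∈ map h xs ] f y ≡ ∑[ x ∈ xs ] f (h x)
    ∑∈-map h []       f = refl
    ∑∈-map h (x ∷ xs) f = cong (f (h x) +_) (∑∈-map h xs f)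

    ∑∈-distrib-+ : ∀ (xs : List A) (f g : A → ℕ) →
                   ∑[ x ∈ xs ] (f x + g x) ≡ ∑[ x ∈ xs ] f x + ∑[ x ∈ xs ] g x
    ∑∈-distrib-+ []       f g = refl
    ∑∈-distrib-+ (x ∷ xs) f g =
      trans (cong (f x + g x +_) (∑∈-distrib-+ xs f g)) (interchange (f x) (g x) _ _)

    *-distribˡ-∑∈ : ∀ c (xs : List A) (f : A → ℕ) → c * ∑[ x ∈ xs ] f x ≡ ∑[ x ∈ xs ] (c * f x)
    *-distribˡ-∑∈ c []       f = *-zeroʳ c
    *-distribˡ-∑∈ c (x ∷ xs) f =
      trans (*-distribˡ-+ c (f x) _) (cong (c * f x +_) (*-distribˡ-∑∈ c xs f))

    ∑∈-∑-comm : ∀ {n} (xs : List A) (f : A → Fin n → ℕ) →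
                ∑[ x ∈ xs ] ∑[ i < n ] f x i ≡ ∑[ i < n ] ∑[ x ∈ xs ] f x i
    ∑∈-∑-comm {n} []       f = sym (sum-replicate-zero n)
    ∑∈-∑-comm     (x ∷ xs) f =
      trans (cong (sum (f x) +_) (∑∈-∑-comm xs f)) (sym (∑-distrib-+ (f x) _))

  ∑-1≡n : ∀ n → ∑[ _ < n ] 1 ≡ n
  ∑-1≡n zero    = refl
  ∑-1≡n (suc n) = cong suc (∑-1≡n n)

  toℕ : Bool → ℕ
  toℕ false = 0
  toℕ true  = 1

  toℕ-∧ : ∀ a b → toℕ (a ∧ b) ≡ toℕ a * toℕ b
  toℕ-∧ false b = refl
  toℕ-∧ true  b = sym (+-identityʳ (toℕ b))

  toℕ-does-*-cong : ∀ {P : Set} (P? : Dec P) {a b} → (P → a ≡ b) →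
                    toℕ (does P?) * a ≡ toℕ (does P?) * b
  toℕ-does-*-cong (yes p) a≡b = cong (1 *_) (a≡b p)
  toℕ-does-*-cong (no  _) a≡b = refl

  length-filter : ∀ {A : Set} {P : A → Set} (P? : ∀ x → Dec (P x)) (xs : List A) →
                  length (filter P? xs) ≡ ∑[ x ∈ xs ] toℕ (does (P? x))
  length-filter P? []       = refl
  length-filter P? (x ∷ xs) with does (P? x)
  ... | true  = cong suc (length-filter P? xs)
  ... | false = length-filter P? xs

  ∣p∣≡∑ : ∀ {n} (p : Subset n) → ∣ p ∣ ≡ ∑[ i < n ] toℕ (lookup p i)
  ∣p∣≡∑ []            = refl
  ∣p∣≡∑ (inside  ∷ p) = cong suc (∣p∣≡∑ p)
  ∣p∣≡∑ (outside ∷ p) = ∣p∣≡∑ p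

  toggle : ∀ {n} → Fin n → Subset n → Subset n
  toggle i p = p [ i ]%= not

  ∣toggle∣≡suc∣p∣ : ∀ {n} (i : Fin n) (p : Subset n) → lookup p i ≡ outside →
                    ∣ toggle i p ∣ ≡ suc ∣ p ∣
  ∣toggle∣≡suc∣p∣ zero    (outside ∷ p) _   = refl
  ∣toggle∣≡suc∣p∣ (suc i) (inside  ∷ p) i∉p = cong suc (∣toggle∣≡suc∣p∣ i p i∉p)
  ∣toggle∣≡suc∣p∣ (suc i) (outside ∷ p) i∉p = ∣toggle∣≡suc∣p∣ i p i∉p

  ∈toggle : ∀ {n} {i : Fin n} (p : Subset n) → lookup p i ≡ outside → i ∈ toggle i p
  ∈toggle {i = i} p i∉p = lookup⇒[]= i _ (trans (lookup∘updateAt i p) (cong not i∉p))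

  ∈⇒∈toggle : ∀ {n} {i j : Fin n} (p : Subset n) → lookup p i ≡ outside → j ∈ p → j ∈ toggle i p
  ∈⇒∈toggle {i = i} {j} p i∉p j∈p with j ≟ᶠ i
  ... | yes refl = contradiction (trans (sym ([]=⇒lookup j∈p)) i∉p) λ ()
  ... | no  j≢i  = lookup⇒[]= j _ (trans (lookup∘updateAt′ j i j≢i p) ([]=⇒lookup j∈p))

  ∈toggle⇒∈ : ∀ {n} {i j : Fin n} (p : Subset n) → j ≢ i → j ∈ toggle i p → j ∈ p
  ∈toggle⇒∈ {i = i} {j} p j≢i j∈p′ =
    lookup⇒[]= j p (trans (sym (lookup∘updateAt′ j i j≢i p)) ([]=⇒lookup j∈p′))

  ∑-allSubsets-suc : ∀ n (f : Subset (suc n) → ℕ) →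
                     ∑[ p ∈ allSubsets (suc n) ] f p
                       ≡ ∑[ p ∈ allSubsets n ] f (inside ∷ p) + ∑[ p ∈ allSubsets n ] f (outside ∷ p)
  ∑-allSubsets-suc n f = begin
    ∑[ p ∈ map (inside ∷_) ps ++ map (outside ∷_) ps ] f p
      ≡⟨ ∑∈-++ (map (inside ∷_) ps) _ f ⟩
    ∑[ p ∈ map (inside ∷_) ps ] f p + ∑[ p ∈ map (outside ∷_) ps ] f p
      ≡⟨ cong₂ _+_ (∑∈-map (inside ∷_) ps f) (∑∈-map (outside ∷_) ps f) ⟩
    ∑[ p ∈ ps ] f (inside ∷ p) + ∑[ p ∈ ps ] f (outside ∷ p) ∎
    where open ≡-Reasoning
          ps = allSubsets n

  ∑-allSubsets-toggle : ∀ {n} (i : Fin n) (f : Subset n → ℕ) →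
                        ∑[ p ∈ allSubsets n ] f p ≡ ∑[ p ∈ allSubsets n ] f (toggle i p)
  ∑-allSubsets-toggle {suc n} zero f = begin
    ∑[ p ∈ allSubsets (suc n) ] f p
      ≡⟨ ∑-allSubsets-suc n f ⟩
    ∑[ p ∈ ps ] f (inside ∷ p) + ∑[ p ∈ ps ] f (outside ∷ p)
      ≡⟨ +-comm (∑[ p ∈ ps ] f (inside ∷ p)) _ ⟩
    ∑[ p ∈ ps ] f (outside ∷ p) + ∑[ p ∈ ps ] f (inside ∷ p)
      ≡⟨ ∑-allSubsets-suc n (f ∘ toggle zero) ⟨
    ∑[ p ∈ allSubsets (suc n) ] f (toggle zero p) ∎
    where open ≡-Reasoning
          ps = allSubsets n
  ∑-allSubsets-toggle {suc n} (suc i) f = begin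
    ∑[ p ∈ allSubsets (suc n) ] f p
      ≡⟨ ∑-allSubsets-suc n f ⟩
    ∑[ p ∈ ps ] f (inside ∷ p) + ∑[ p ∈ ps ] f (outside ∷ p)
      ≡⟨ cong₂ _+_ (∑-allSubsets-toggle i (f ∘ (inside ∷_)))
                   (∑-allSubsets-toggle i (f ∘ (outside ∷_))) ⟩
    ∑[ p ∈ ps ] f (inside ∷ toggle i p) + ∑[ p ∈ ps ] f (outside ∷ toggle i p)
      ≡⟨ ∑-allSubsets-suc n (f ∘ toggle (suc i)) ⟨
    ∑[ p ∈ allSubsets (suc n) ] f (toggle (suc i) p) ∎
    where open ≡-Reasoning
          ps = allSubsets n

  module _ {n : ℕ} (G : Graph n) where

    adjacentTo? : (A : Subset n) (v : Fin n) → Dec (∃ λ u → u ∈ A × Adj G u v)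
    adjacentTo? A v = any? (λ u → (u ∈? A) ×-dec (adj G u v Bool.≟ true))

    lookup-N : ∀ A v → lookup (N G A) v ≡ does (adjacentTo? A v)
    lookup-N A v = trans (lookup∘tabulate _ v) (isYes≗does (adjacentTo? A v))

    ∈N⇒adjacent : ∀ {A v} → lookup (N G A) v ≡ true → ∃ λ u → u ∈ A × Adj G u v
    ∈N⇒adjacent {A} {v} v∈NA with adjacentTo? A v | lookup-N A v
    ... | yes adjacent | _  = adjacent
    ... | no  _        | eq = contradiction (trans (sym eq) v∈NA) λ ()

    ∉N⇒nonadjacent : ∀ {A v} → lookup (N G A) v ≡ false → ∀ {u} → u ∈ A → adj G u v ≡ false
    ∉N⇒nonadjacent {A} {v} v∉NA {u} u∈A with adj G u v in uv
    ... | false = refl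
    ... | true  with adjacentTo? A v | lookup-N A v
    ...   | yes _  | eq = contradiction (trans (sym eq) v∉NA) λ ()
    ...   | no ¬uv | _  = contradiction (u , u∈A , uv) ¬uv

    nonadjacent⇒∉N : ∀ {A v} → (∀ {u} → u ∈ A → adj G u v ≡ false) → lookup (N G A) v ≡ false
    nonadjacent⇒∉N {A} {v} nonadj with lookup (N G A) v in v∈NA
    ... | false = refl
    ... | true  with ∈N⇒adjacent v∈NA
    ...   | u , u∈A , uv = contradiction (trans (sym uv) (nonadj u∈A)) λ ()

    IndependentOfSize : ℕ → Subset n → Set
    IndependentOfSize k T = Independent G T × ∣ T ∣ ≡ k

    independentOfSize? : ∀ k T → Dec (IndependentOfSize k T)
    independentOfSize? k T = independent? G T ×-dec (∣ T ∣ ≟ k)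

    toggle-independent⇔ : ∀ {k T v} → lookup T v ≡ outside →
                          IndependentOfSize (suc k) (toggle v T)
                            ⇔ (IndependentOfSize k T × lookup (N G T) v ≡ false)
    toggle-independent⇔ {k} {T} {v} v∉T = mk⇔ shrink extend
      where
      shrink : IndependentOfSize (suc k) (toggle v T) → IndependentOfSize k T × lookup (N G T) v ≡ false
      shrink (indep , size) =
        ( (λ u w u∈T w∈T → indep u w (∈⇒∈toggle T v∉T u∈T) (∈⇒∈toggle T v∉T w∈T))
        , suc-injective (trans (sym (∣toggle∣≡suc∣p∣ v T v∉T)) size) )
        , nonadjacent⇒∉N (λ u∈T → indep _ v (∈⇒∈toggle T v∉T u∈T) (∈toggle T v∉T))

      extend : IndependentOfSize k T × lookup (N G T) v ≡ false → IndependentOfSize (suc k) (toggle v T)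
      extend ((indep , size) , v∉NT) = indep′ , trans (∣toggle∣≡suc∣p∣ v T v∉T) (cong suc size)
        where
        indep′ : Independent G (toggle v T)
        indep′ u w u∈T′ w∈T′ with u ≟ᶠ v | w ≟ᶠ v
        ... | yes refl | yes refl = irref G u
        ... | yes refl | no w≢v   = trans (adj-sym G u w) (∉N⇒nonadjacent v∉NT (∈toggle⇒∈ T w≢v w∈T′))
        ... | no u≢v   | yes refl = ∉N⇒nonadjacent v∉NT (∈toggle⇒∈ T u≢v u∈T′)
        ... | no u≢v   | no w≢v   = indep u w (∈toggle⇒∈ T u≢v u∈T′) (∈toggle⇒∈ T w≢v w∈T′)

    χ : ℕ → Subset n → ℕ
    χ k T = toℕ (does (independentOfSize? k T))

    s≡∑χ : ∀ k → s G k ≡ ∑[ T ∈ allSubsets n ] χ k T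
    s≡∑χ k = length-filter (independentOfSize? k) (allSubsets n)

    ∑χ-cong : ∀ k {f g : Subset n → ℕ} → (∀ T → IndependentOfSize k T → f T ≡ g T) →
              ∑[ T ∈ allSubsets n ] (χ k T * f T) ≡ ∑[ T ∈ allSubsets n ] (χ k T * g T)
    ∑χ-cong k f≗g = ∑∈-cong (allSubsets n) λ T → toℕ-does-*-cong (independentOfSize? k T) (f≗g T)

    ∑χ-const : ∀ k c → ∑[ T ∈ allSubsets n ] (χ k T * c) ≡ c * s G k
    ∑χ-const k c = begin
      ∑[ T ∈ allSubsets n ] (χ k T * c) ≡⟨ ∑∈-cong (allSubsets n) (λ T → *-comm (χ k T) c) ⟩
      ∑[ T ∈ allSubsets n ] (c * χ k T) ≡⟨ *-distribˡ-∑∈ c (allSubsets n) (χ k) ⟨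
      c * ∑[ T ∈ allSubsets n ] χ k T   ≡⟨ cong (c *_) (s≡∑χ k) ⟨
      c * s G k                         ∎
      where open ≡-Reasoning

    ∑χ-size : ∀ k → ∑[ T ∈ allSubsets n ] (χ k T * ∣ T ∣) ≡ k * s G k
    ∑χ-size k = trans (∑χ-cong k (λ _ → proj₂)) (∑χ-const k k)

    free : Subset n → Fin n → Bool
    free T v = not (lookup T v) ∧ not (lookup (N G T) v)

    freeCount : Subset n → ℕ
    freeCount T = ∑[ v < n ] toℕ (free T v)

    χ-toggle : ∀ k v T → χ (suc k) (toggle v T) * toℕ (lookup (toggle v T) v) ≡ χ k T * toℕ (free T v)
    χ-toggle k v T rewrite lookup∘updateAt v {not} T with lookup T v in v∉T
    ... | true  = trans (*-zeroʳ (χ (suc k) (toggle v T))) (sym (*-zeroʳ (χ k T)))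
    ... | false = begin
      χ (suc k) (toggle v T) * 1
        ≡⟨ *-identityʳ _ ⟩
      toℕ (does (independentOfSize? (suc k) (toggle v T)))
        ≡⟨ cong toℕ (does-⇔ (toggle-independent⇔ v∉T) (independentOfSize? (suc k) (toggle v T))
                              (independentOfSize? k T ×-dec (v∈NT Bool.≟ false))) ⟩
      toℕ (does (independentOfSize? k T) ∧ does (v∈NT Bool.≟ false))
        ≡⟨ toℕ-∧ (does (independentOfSize? k T)) _ ⟩
      χ k T * toℕ (does (v∈NT Bool.≟ false))
        ≡⟨ cong (λ b → χ k T * toℕ b) (does-≟-false v∈NT) ⟩
      χ k T * toℕ (not v∈NT) ∎
      where
      open ≡-Reasoning
      v∈NT = lookup (N G T) v
      does-≟-false : ∀ b → does (b Bool.≟ false) ≡ not b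
      does-≟-false false = refl
      does-≟-false true  = refl

    -- Reindexing the inner sum by T ↦ toggle v T pairs each (k+1)-set containing v
    -- with the k-set obtained by removing v.
    ∑χ-double-count : ∀ k → ∑[ T ∈ allSubsets n ] (χ (suc k) T * ∣ T ∣)
                              ≡ ∑[ T ∈ allSubsets n ] (χ k T * freeCount T)
    ∑χ-double-count k = begin
      ∑[ T ∈ 𝒮 ] (χ (suc k) T * ∣ T ∣)
        ≡⟨ ∑∈-cong 𝒮 (λ T → trans (cong (χ (suc k) T *_) (∣p∣≡∑ T))
                                   (*-distribˡ-sum (χ (suc k) T) (toℕ ∘ lookup T))) ⟩
      ∑[ T ∈ 𝒮 ] ∑[ v < n ] (χ (suc k) T * toℕ (lookup T v))
        ≡⟨ ∑∈-∑-comm 𝒮 (λ T v → χ (suc k) T * toℕ (lookup T v)) ⟩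
      ∑[ v < n ] ∑[ T ∈ 𝒮 ] (χ (suc k) T * toℕ (lookup T v))
        ≡⟨ sum-cong-≗ (λ v → ∑-allSubsets-toggle v (λ T → χ (suc k) T * toℕ (lookup T v))) ⟩
      ∑[ v < n ] ∑[ T ∈ 𝒮 ] (χ (suc k) (toggle v T) * toℕ (lookup (toggle v T) v))
        ≡⟨ sum-cong-≗ (λ v → ∑∈-cong 𝒮 (χ-toggle k v)) ⟩
      ∑[ v < n ] ∑[ T ∈ 𝒮 ] (χ k T * toℕ (free T v))
        ≡⟨ ∑∈-∑-comm 𝒮 (λ T v → χ k T * toℕ (free T v)) ⟨
      ∑[ T ∈ 𝒮 ] ∑[ v < n ] (χ k T * toℕ (free T v))
        ≡⟨ ∑∈-cong 𝒮 (λ T → *-distribˡ-sum (χ k T) (toℕ ∘ free T)) ⟨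
      ∑[ T ∈ 𝒮 ] (χ k T * freeCount T) ∎
      where open ≡-Reasoning
            𝒮 = allSubsets n

    freeCount-partition : ∀ {T} → Independent G T → freeCount T + (∣ T ∣ + ∣ N G T ∣) ≡ n
    freeCount-partition {T} indep = begin
      freeCount T + (∣ T ∣ + ∣ N G T ∣)
        ≡⟨ cong (freeCount T +_) (cong₂ _+_ (∣p∣≡∑ T) (∣p∣≡∑ (N G T))) ⟩
      freeCount T + (∑[ v < n ] toℕ (lookup T v) + ∑[ v < n ] toℕ (lookup (N G T) v))
        ≡⟨ cong (freeCount T +_) (∑-distrib-+ (toℕ ∘ lookup T) (toℕ ∘ lookup (N G T))) ⟨
      freeCount T + ∑[ v < n ] (toℕ (lookup T v) + toℕ (lookup (N G T) v))
        ≡⟨ ∑-distrib-+ (toℕ ∘ free T) _ ⟨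
      ∑[ v < n ] (toℕ (free T v) + (toℕ (lookup T v) + toℕ (lookup (N G T) v)))
        ≡⟨ sum-cong-≗ (λ v → exactly-one (lookup T v) (lookup (N G T) v) (T∩NT≡∅ v)) ⟩
      ∑[ v < n ] 1
        ≡⟨ ∑-1≡n n ⟩
      n ∎
      where
      open ≡-Reasoning
      T∩NT≡∅ : ∀ v → lookup T v ≡ true → lookup (N G T) v ≡ true → ⊥
      T∩NT≡∅ v v∈T v∈NT with ∈N⇒adjacent v∈NT
      ... | u , u∈T , uv = contradiction (trans (sym uv) (indep u v u∈T (lookup⇒[]= v T v∈T))) λ ()
      exactly-one : ∀ a b → (a ≡ true → b ≡ true → ⊥) → toℕ (not a ∧ not b) + (toℕ a + toℕ b) ≡ 1
      exactly-one false false _   = refl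
      exactly-one false true  _   = refl
      exactly-one true  false _   = refl
      exactly-one true  true  a∩b = contradiction refl (a∩b refl)

    count-identity : ∀ k → suc k * s G (suc k) + ∑[ T ∈ allSubsets n ] (χ k T * (k + ∣ N G T ∣))
                             ≡ n * s G k
    count-identity k = begin
      suc k * s G (suc k) + ∑[ T ∈ 𝒮 ] (χ k T * (k + ∣ N G T ∣))
        ≡⟨ cong (_+ ∑[ T ∈ 𝒮 ] (χ k T * (k + ∣ N G T ∣)))
                (trans (sym (∑χ-size (suc k))) (∑χ-double-count k)) ⟩
      ∑[ T ∈ 𝒮 ] (χ k T * freeCount T) + ∑[ T ∈ 𝒮 ] (χ k T * (k + ∣ N G T ∣))
        ≡⟨ ∑∈-distrib-+ 𝒮 _ _ ⟨
      ∑[ T ∈ 𝒮 ] (χ k T * freeCount T + χ k T * (k + ∣ N G T ∣))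
        ≡⟨ ∑∈-cong 𝒮 (λ T → *-distribˡ-+ (χ k T) (freeCount T) _) ⟨
      ∑[ T ∈ 𝒮 ] (χ k T * (freeCount T + (k + ∣ N G T ∣)))
        ≡⟨ ∑χ-cong k (λ T (indep , size) →
             trans (cong (λ m → freeCount T + (m + ∣ N G T ∣)) (sym size)) (freeCount-partition indep)) ⟩
      ∑[ T ∈ 𝒮 ] (χ k T * n)
        ≡⟨ ∑χ-const k n ⟩
      n * s G k ∎
      where open ≡-Reasoning
            𝒮 = allSubsets n

open Counting using (sumOver; toℕ; IndependentOfSize; independentOfSize?; χ; ∑χ-const; count-identity)

open import Defs
open import Data.Nat using (ℕ; _<_; NonZero)
open import Data.Integer using (+_) renaming (_≤_ to _≤ℤ_)
open import Data.Rational using (ℚ; 0ℚ; 1ℚ; _*_; _+_; _-_) renaming (_<_ to _<ℚ_; _≤_ to _≤ℚ_)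
open import Data.Nat using () renaming (_≤_ to _≤ℕ_)
open import Data.Product using (_×_)

import Data.Nat as ℕ
import Data.Nat.Properties as ℕ
import Data.Integer as ℤ
import Data.Integer.Properties as ℤ
open import Data.Integer.DivMod using ([n/d]*d≤n)
open import Data.Nat.Coprimality using (1-coprimeTo) renaming (sym to coprime-sym)
import Data.Rational as ℚ
open import Data.Rational using (mkℚ; ↥_; ↧_; -_; floor; ceiling; _÷_; 1/_; *≤*; positive)
open import Data.Rational.Properties
open import Data.Rational.Solver using (module +-*-Solver)
open import Data.List using ([]; _∷_)
open import Data.Fin.Subset using (∣_∣)
open import Data.Product using (_,_)
open import Relation.Binary.PropositionalEquality
open import Relation.Nullary using (Dec; yes; no; does)

ℕ→ℚ≡mkℚ : ∀ m → ℕ→ℚ m ≡ mkℚ (+ m) 0 (coprime-sym (1-coprimeTo m))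
ℕ→ℚ≡mkℚ m = normalize-coprime (coprime-sym (1-coprimeTo m))

ℕ→ℚ-+ : ∀ a b → ℕ→ℚ (a ℕ.+ b) ≡ ℕ→ℚ a + ℕ→ℚ b
ℕ→ℚ-+ a b = begin
  ℕ→ℚ (a ℕ.+ b)
    ≡⟨ cong₂ (λ x y → (x ℤ.+ y) ℚ./ 1) (ℤ.*-identityʳ (+ a)) (ℤ.*-identityʳ (+ b)) ⟨
  (+ a ℤ.* + 1 ℤ.+ + b ℤ.* + 1) ℚ./ 1
    ≡⟨ cong₂ _+_ (ℕ→ℚ≡mkℚ a) (ℕ→ℚ≡mkℚ b) ⟨
  ℕ→ℚ a + ℕ→ℚ b ∎
  where open ≡-Reasoning

ℕ→ℚ-* : ∀ a b → ℕ→ℚ (a ℕ.* b) ≡ ℕ→ℚ a * ℕ→ℚ b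
ℕ→ℚ-* a b = begin
  ℕ→ℚ (a ℕ.* b)                    ≡⟨ cong (ℚ._/ 1) (ℤ.pos-* a b) ⟩
  (+ a ℤ.* + b) ℚ./ 1  ≡⟨ cong₂ _*_ (ℕ→ℚ≡mkℚ a) (ℕ→ℚ≡mkℚ b) ⟨
  ℕ→ℚ a * ℕ→ℚ b                    ∎
  where open ≡-Reasoning

ℕ→ℚ-cancel-≤ : ∀ {a b} → ℕ→ℚ a ≤ℚ ℕ→ℚ b → a ≤ℕ b
ℕ→ℚ-cancel-≤ {a} {b} a≤b rewrite ℕ→ℚ≡mkℚ a | ℕ→ℚ≡mkℚ b =
  ℤ.drop‿+≤+ (subst₂ ℤ._≤_ (ℤ.*-identityʳ (+ a)) (ℤ.*-identityʳ (+ b)) (drop-*≤* a≤b))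

floor*↧≤↥ : ∀ p → floor p ℤ.* ↧ p ≤ℤ ↥ p
floor*↧≤↥ (mkℚ a d-1 _) = [n/d]*d≤n a (+ ℕ.suc d-1)

↥≤ceiling*↧ : ∀ p → ↥ p ≤ℤ ceiling p ℤ.* ↧ p
↥≤ceiling*↧ p@record{} = begin
  ↥ p                               ≡⟨ ℤ.neg-involutive (↥ p) ⟨
  ℤ.- (ℤ.- ↥ p)                     ≡⟨ cong ℤ.-_ (↥-neg p) ⟨
  ℤ.- ↥ (- p)                       ≤⟨ ℤ.neg-mono-≤ (floor*↧≤↥ (- p)) ⟩
  ℤ.- (floor (- p) ℤ.* ↧ (- p))     ≡⟨ ℤ.neg-distribˡ-* (floor (- p)) (↧ (- p)) ⟩
  ceiling p ℤ.* ↧ (- p)             ≡⟨ cong (ceiling p ℤ.*_) (↧-neg p) ⟩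
  ceiling p ℤ.* ↧ p                 ∎
  where open ℤ.≤-Reasoning

ceiling≤⇒≤ : ∀ p j → ceiling p ≤ℤ + j → p ≤ℚ ℕ→ℚ j
ceiling≤⇒≤ p@(mkℚ a _ _) j ⌈p⌉≤j rewrite ℕ→ℚ≡mkℚ j = *≤* (begin
  a ℤ.* + 1          ≡⟨ ℤ.*-identityʳ a ⟩
  a                  ≤⟨ ↥≤ceiling*↧ p ⟩
  ceiling p ℤ.* ↧ p  ≤⟨ ℤ.*-monoʳ-≤-nonNeg (↧ p) ⌈p⌉≤j ⟩
  + j ℤ.* ↧ p        ∎)
  where open ℤ.≤-Reasoning

÷-*-cancel : ∀ p r .{{_ : ℚ.NonZero r}} → (p ÷ r) * r ≡ p
÷-*-cancel p r = trans (*-assoc p (1/ r) r) (trans (cong (p *_) (*-inverseˡ r)) (*-identityʳ p))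

scaled-∑-mono : ∀ {A : Set} c (f g : A → ℕ) → (∀ x → c * ℕ→ℚ (f x) ≤ℚ ℕ→ℚ (g x)) →
                ∀ xs → c * ℕ→ℚ (∑[ x ∈ xs ] f x) ≤ℚ ℕ→ℚ (∑[ x ∈ xs ] g x)
scaled-∑-mono c f g f≤g []       = ≤-reflexive (*-zeroʳ c)
scaled-∑-mono c f g f≤g (x ∷ xs) = begin
  c * ℕ→ℚ (f x ℕ.+ ∑[ y ∈ xs ] f y)          ≡⟨ cong (c *_) (ℕ→ℚ-+ (f x) _) ⟩
  c * (ℕ→ℚ (f x) + ℕ→ℚ (∑[ y ∈ xs ] f y))    ≡⟨ *-distribˡ-+ c (ℕ→ℚ (f x)) _ ⟩
  c * ℕ→ℚ (f x) + c * ℕ→ℚ (∑[ y ∈ xs ] f y)  ≤⟨ +-mono-≤ (f≤g x) (scaled-∑-mono c f g f≤g xs) ⟩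
  ℕ→ℚ (g x) + ℕ→ℚ (∑[ y ∈ xs ] g y)          ≡⟨ ℕ→ℚ-+ (g x) _ ⟨
  ℕ→ℚ (g x ℕ.+ ∑[ y ∈ xs ] g y)              ∎
  where open ≤-Reasoning

module _ {n : ℕ} (G : Graph n) (λ' : ℚ) (quasiRegular : QuasiRegularizable λ' G) where

  open +-*-Solver

  nbhdSum : ℕ → ℕ
  nbhdSum k = ∑[ T ∈ allSubsets n ] (χ G k T ℕ.* (k ℕ.+ ∣ N G T ∣))

  closedNbhd-bound : ∀ {k T} → IndependentOfSize G k T → (λ' + 1ℚ) * ℕ→ℚ k ≤ℚ ℕ→ℚ (k ℕ.+ ∣ N G T ∣)
  closedNbhd-bound {k} {T} (indep , size) = begin
    (λ' + 1ℚ) * ℕ→ℚ k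
      ≡⟨ solve 2 (λ l K → (l :+ con 1ℚ) :* K := l :* K :+ K) refl λ' (ℕ→ℚ k) ⟩
    λ' * ℕ→ℚ k + ℕ→ℚ k
      ≤⟨ +-monoˡ-≤ (ℕ→ℚ k) (subst (λ m → λ' * ℕ→ℚ m ≤ℚ ℕ→ℚ ∣NT∣) size (quasiRegular T indep)) ⟩
    ℕ→ℚ ∣NT∣ + ℕ→ℚ k
      ≡⟨ +-comm (ℕ→ℚ ∣NT∣) (ℕ→ℚ k) ⟩
    ℕ→ℚ k + ℕ→ℚ ∣NT∣
      ≡⟨ ℕ→ℚ-+ k ∣NT∣ ⟨
    ℕ→ℚ (k ℕ.+ ∣NT∣) ∎
    where
    open ≤-Reasoning
    ∣NT∣ = ∣ N G T ∣

  nbhdSum-bound : ∀ k → (λ' + 1ℚ) * ℕ→ℚ (k ℕ.* s G k) ≤ℚ ℕ→ℚ (nbhdSum k)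
  nbhdSum-bound k =
    subst (λ m → (λ' + 1ℚ) * ℕ→ℚ m ≤ℚ ℕ→ℚ (nbhdSum k)) (∑χ-const G k k)
          (scaled-∑-mono (λ' + 1ℚ) _ _ (λ T → bound T (independentOfSize? G k T)) (allSubsets n))
    where
    bound : ∀ T (T? : Dec (IndependentOfSize G k T)) →
            (λ' + 1ℚ) * ℕ→ℚ (toℕ (does T?) ℕ.* k) ≤ℚ ℕ→ℚ (toℕ (does T?) ℕ.* (k ℕ.+ ∣ N G T ∣))
    bound T (no _)        = ≤-reflexive (*-zeroʳ (λ' + 1ℚ))
    bound T (yes T∈Iₖ) rewrite ℕ.*-identityˡ k | ℕ.*-identityˡ (k ℕ.+ ∣ N G T ∣) = closedNbhd-bound T∈Iₖ

  recurrence : ∀ k → ℕ→ℚ (ℕ.suc k) * ℕ→ℚ (s G (ℕ.suc k)) ≤ℚ (ℕ→ℚ n - (λ' + 1ℚ) * ℕ→ℚ k) * ℕ→ℚ (s G k)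
  recurrence k = begin
    Xₖ                               ≡⟨ solve 2 (λ x m → x := x :+ m :- m) refl Xₖ Mₖ ⟩
    Xₖ + Mₖ - Mₖ                     ≡⟨ cong (_- Mₖ) counted ⟩
    ℕ→ℚ n * Sₖ - Mₖ                  ≤⟨ +-monoʳ-≤ (ℕ→ℚ n * Sₖ) (neg-antimono-≤ bounded) ⟩
    ℕ→ℚ n * Sₖ - (λ' + 1ℚ) * (ℕ→ℚ k * Sₖ)
      ≡⟨ solve 4 (λ N l K S → N :* S :- (l :+ con 1ℚ) :* (K :* S) := (N :- (l :+ con 1ℚ) :* K) :* S)
               refl (ℕ→ℚ n) λ' (ℕ→ℚ k) Sₖ ⟩
    (ℕ→ℚ n - (λ' + 1ℚ) * ℕ→ℚ k) * Sₖ ∎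
    where
    open ≤-Reasoning
    Xₖ = ℕ→ℚ (ℕ.suc k) * ℕ→ℚ (s G (ℕ.suc k))
    Sₖ = ℕ→ℚ (s G k)
    Mₖ = ℕ→ℚ (nbhdSum k)
    counted : Xₖ + Mₖ ≡ ℕ→ℚ n * Sₖ
    counted = begin-equality
      Xₖ + Mₖ
        ≡⟨ cong (_+ Mₖ) (ℕ→ℚ-* (ℕ.suc k) (s G (ℕ.suc k))) ⟨
      ℕ→ℚ (ℕ.suc k ℕ.* s G (ℕ.suc k)) + Mₖ
        ≡⟨ ℕ→ℚ-+ (ℕ.suc k ℕ.* s G (ℕ.suc k)) (nbhdSum k) ⟨
      ℕ→ℚ (ℕ.suc k ℕ.* s G (ℕ.suc k) ℕ.+ nbhdSum k)
        ≡⟨ cong ℕ→ℚ (count-identity G k) ⟩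
      ℕ→ℚ (n ℕ.* s G k)
        ≡⟨ ℕ→ℚ-* n (s G k) ⟩
      ℕ→ℚ n * Sₖ ∎
    bounded : (λ' + 1ℚ) * (ℕ→ℚ k * Sₖ) ≤ℚ Mₖ
    bounded = subst (λ x → (λ' + 1ℚ) * x ≤ℚ Mₖ) (ℕ→ℚ-* k (s G k)) (nbhdSum-bound k)

  s-decreasing : ∀ j → ℕ→ℚ n - (λ' + 1ℚ) * ℕ→ℚ j ≤ℚ ℕ→ℚ (ℕ.suc j) → s G (ℕ.suc j) ≤ℕ s G j
  s-decreasing j coefficient≤j+1 =
    ℕ→ℚ-cancel-≤ (*-cancelˡ-≤-pos (ℕ→ℚ (ℕ.suc j)) {{normalize-pos (ℕ.suc j) 1}} (begin
      ℕ→ℚ (ℕ.suc j) * ℕ→ℚ (s G (ℕ.suc j))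
        ≤⟨ recurrence j ⟩
      (ℕ→ℚ n - (λ' + 1ℚ) * ℕ→ℚ j) * ℕ→ℚ (s G j)
        ≤⟨ *-monoʳ-≤-nonNeg (ℕ→ℚ (s G j)) {{normalize-nonNeg (s G j) 1}} coefficient≤j+1 ⟩
      ℕ→ℚ (ℕ.suc j) * ℕ→ℚ (s G j) ∎))
    where open ≤-Reasoning

coefficient≤ : ∀ n λ' (λpos : 0ℚ <ℚ λ') j → rIndex n λ' λpos ≤ℤ + j →
               ℕ→ℚ n - (λ' + 1ℚ) * ℕ→ℚ j ≤ℚ ℕ→ℚ (ℕ.suc j)
coefficient≤ n λ' λpos j r≤j = begin
  ℕ→ℚ n - (λ' + 1ℚ) * ℕ→ℚ j
    ≡⟨ solve 3 (λ N J l → N :- (l :+ con 1ℚ) :* J := (N :- con 1ℚ) :+ (con 1ℚ :- (l :+ con 1ℚ) :* J))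
             refl (ℕ→ℚ n) (ℕ→ℚ j) λ' ⟩
  (ℕ→ℚ n - 1ℚ) + (1ℚ - (λ' + 1ℚ) * ℕ→ℚ j)
    ≤⟨ +-monoˡ-≤ (1ℚ - (λ' + 1ℚ) * ℕ→ℚ j) n-1≤jL ⟩
  ℕ→ℚ j * L + (1ℚ - (λ' + 1ℚ) * ℕ→ℚ j)
    ≡⟨ solve 2 (λ J l → J :* (l :+ con (ℕ→ℚ 2)) :+ (con 1ℚ :- (l :+ con 1ℚ) :* J) := con 1ℚ :+ J)
             refl (ℕ→ℚ j) λ' ⟩
  1ℚ + ℕ→ℚ j
    ≡⟨ ℕ→ℚ-+ 1 j ⟨
  ℕ→ℚ (ℕ.suc j) ∎
  where
  open ≤-Reasoning
  open +-*-Solver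
  L = λ' + ℕ→ℚ 2
  instance
    L-pos : ℚ.Positive L
    L-pos = pos+pos⇒pos λ' {{positive λpos}} (ℕ→ℚ 2) {{normalize-pos 2 1}}
    L-nonZero : ℚ.NonZero L
    L-nonZero = pos⇒nonZero L
    L-nonNeg : ℚ.NonNegative L
    L-nonNeg = pos⇒nonNeg L
  n-1≤jL : ℕ→ℚ n - 1ℚ ≤ℚ ℕ→ℚ j * L
  n-1≤jL = subst (_≤ℚ ℕ→ℚ j * L) (÷-*-cancel (ℕ→ℚ n - 1ℚ) L)
                 (*-monoʳ-≤-nonNeg L (ceiling≤⇒≤ ((ℕ→ℚ n - 1ℚ) ÷ L) j r≤j))

mainTheorem1 : (n : ℕ) → .{{_ : NonZero n}} → (G : Graph n) →
    (λ' : ℚ) → (λpos : 0ℚ <ℚ λ') → QuasiRegularizable λ' G →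
    (α : ℕ) → IsIndependenceNumber G α →
    ((k : ℕ) → k < α →
      ℕ→ℚ (Data.Nat.suc k) * ℕ→ℚ (s G (Data.Nat.suc k))
        ≤ℚ (ℕ→ℚ n - (λ' + 1ℚ) * ℕ→ℚ k) * ℕ→ℚ (s G k))
    × ((j : ℕ) → rIndex n λ' λpos ≤ℤ + j → j < α →
      s G (Data.Nat.suc j) ≤ℕ s G j)
mainTheorem1 n G λ' λpos quasiRegular α _ =
    (λ k _ → recurrence G λ' quasiRegular k)
  , (λ j r≤j _ → s-decreasing G λ' quasiRegular j (coefficient≤ n λ' λpos j r≤j))
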